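{- Let $\mathcal{G}=(X,E)$ be a $d$-uniform hypergraph on $n$ vertices with $d$-dimensional adjacency matrix $\mathbb{A}$, and let $P$ be the color matrix of a coloring $f$ of $\mathcal{G}$ into $k$ colors. Then $f$ is perfect if and only if there exists a $d$-dimensional matrix $\mathbb{S}$ of order $k$ such that $\mathbb{A}\circ P=P\circ\mathbb{S}$. Moreover, in this case the entries of $\mathbb{S}$ are $$s_\gamma=v_{\gamma_1,\gamma}\cdot\binom{d-1}{d_1,\dots,d_k}^{ -1},\qquad \gamma=(\gamma_1,\dots,\gamma_d)\in[k]^d.$$ Here $v_{\gamma_1,\gamma}$ is the number of hyperedges whose color range is the multiset $\{\gamma_1,\dots,\gamma_d\}$ and which contain a given vertex of color $\gamma_1$ (this number does not depend on the chosen vertex), $d_l$ is the number of times the color $l$ occurs in the multiset $\{\gamma_2,\dots,\gamma_d\}$, and $\binom{d-1}{d_1,\dots,d_k}$ is the multinomial coefficient.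
   Context: A $d$-uniform hypergraph has a finite vertex set, identified with $[n]=\{1,\dots,n\}$, and hyperedges that are $d$-element subsets of it. Its adjacency matrix $\mathbb{A}$ is the $d$-dimensional array $(a_\alpha)_{\alpha\in[n]^d}$ with $a_{(x_1,\dots,x_d)}=1/(d-1)!$ if $\{x_1,\dots,x_d\}$ is a hyperedge (so the $x_i$ are distinct), and $a_{(x_1,\dots,x_d)}=0$ otherwise. Product $\circ$: let $\mathbb{A}$ be a $d$-dimensional array indexed by $[n]\times[p]^{d-1}$ and $\mathbb{B}$ a $t$-dimensional array indexed by $[p]\times[q]^{t-1}$ (ordinary matrices are $2$-dimensional arrays, vectors are $1$-dimensional). Then $\mathbb{A}\circ\mathbb{B}$ is the $((d-1)(t-1)+1)$-dimensional array with entries $$c_{i,\beta^2,\dots,\beta^d}=\sum_{i_2,\dots,i_d\in[p]}a_{i,i_2,\dots,i_d}\,b_{i_2,\beta^2}\cdots b_{i_d,\beta^d},\qquad \beta^j\in[q]^{t-1}.$$ In particular, for an $n\times k$ matrix $P$ and a $d$-dimensional $\mathbb{S}$ of order $k$, $(P\circ\mathbb{S})_{x,\beta}=\sum_{i}p_{x,i}s_{i,\beta}$. A coloring is a surjective map $f:[n]\to[k]$. Its color matrix $P$ is $n\times k$ with $p_{x,i}=1$ if $f(x)=i$ and $0$ otherwise. The color range of a hyperedge $e$ is the multiset $\{f(x):x\in e\}$. The coloring $f$ is perfect if, for each color $i$ and each multiset $\gamma$, all vertices of color $i$ lie in the same number of hyperedges of color range $\gamma$. -}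

module Defs where

open import Data.Bool using (Bool; true; false; T; if_then_else_)
open import Data.Nat as ℕ using (ℕ; zero; suc; _!)
open import Data.Nat.Properties using (_!≢0)
open import Data.Fin using (Fin; zero; suc; _≟_)
open import Data.Fin.Properties using (any?)
open import Data.Fin.Subset using (Subset; _∈_; ∣_∣; inside; outside)
open import Data.Fin.Subset.Properties using (_∈?_)
open import Data.Vec as Vec using (Vec; []; _∷_; tabulate)
open import Data.Vec.Properties using (≡-dec)
open import Data.Vec.Functional as VF using (Vector)
open import Data.List as List using (List; _++_)
open import Data.Integer using (+_)
open import Data.Rational using (ℚ; 0ℚ; 1ℚ; _+_; _*_; _/_)
open import Data.Product using (∃; _×_)
open import Relation.Nullary using (does; _×-dec_)
open import Relation.Binary.PropositionalEquality using (_≡_)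

sumFin : ∀ {n} → (Fin n → ℚ) → ℚ
sumFin {zero}  g = 0ℚ
sumFin {suc n} g = g zero + sumFin (λ i → g (suc i))

prodFin : ∀ {n} → (Fin n → ℚ) → ℚ
prodFin {zero}  g = 1ℚ
prodFin {suc n} g = g zero * prodFin (λ i → g (suc i))

prodFinℕ : ∀ {n} → (Fin n → ℕ) → ℕ
prodFinℕ {zero}  g = 1
prodFinℕ {suc n} g = g zero ℕ.* prodFinℕ (λ i → g (suc i))

countFin : ∀ {n} → (Fin n → Bool) → ℕ
countFin {zero}  p = 0
countFin {suc n} p = (if p zero then 1 else 0) ℕ.+ countFin (λ i → p (suc i))

countList : ∀ {A : Set} → (A → Bool) → List A → ℕ
countList p List.[]       = 0
countList p (a List.∷ as) = (if p a then 1 else 0) ℕ.+ countList p as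

sumTuples : ∀ m {n} → ((Fin m → Fin n) → ℚ) → ℚ
sumTuples zero    g = g (λ ())
sumTuples (suc m) g = sumFin (λ i → sumTuples m (λ ι → g (i VF.∷ ι)))

allSubsets : ∀ n → List (Subset n)
allSubsets zero    = [] List.∷ List.[]
allSubsets (suc n) = List.map (inside ∷_) (allSubsets n) ++ List.map (outside ∷_) (allSubsets n)

-- A (suc m)-dimensional array indexed by [n] × [p]^m, with rational entries.
Array : ℕ → ℕ → ℕ → Set
Array m n p = Fin n → (Fin m → Fin p) → ℚ

Matrix : ℕ → ℕ → Set
Matrix n p = Fin n → Fin p → ℚ

_∘M_ : ∀ {m n p q} → Array m n p → Matrix p q → Array m n q
_∘M_ {m} A B i β = sumTuples m (λ ι → A i ι * prodFin (λ j → B (ι j) (β j)))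

_M∘_ : ∀ {m n p q} → Matrix n p → Array m p q → Array m n q
_M∘_ P S x β = sumFin (λ i → P x i * S i β)

record Hypergraph (n d : ℕ) : Set where
  field
    isEdge  : Subset n → Bool
    uniform : ∀ e → T (isEdge e) → ∣ e ∣ ≡ d
open Hypergraph public

image : ∀ {d n} → (Fin d → Fin n) → Subset n
image α = tabulate (λ y → does (any? (λ i → α i ≟ y)))

-- adjacency array of a (suc m)-uniform hypergraph:
-- a_(x₁,…,x_d) = 1/(d-1)! if {x₁,…,x_d} is a hyperedge, 0 otherwise.
-- The first index is split off: adjacency H x ι = a_(x, ι₁, …, ι_m).
adjacency : ∀ {n m} → Hypergraph n (suc m) → Array m n n
adjacency {n} {m} H x ι =
  if isEdge H (image (x VF.∷ ι)) then (+ 1 / (m !)) {{m !≢0}} else 0ℚ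

Surjective : ∀ {n k} → (Fin n → Fin k) → Set
Surjective {n} {k} f = ∀ (i : Fin k) → ∃ (λ (x : Fin n) → f x ≡ i)

colorMatrix : ∀ {n k} → (Fin n → Fin k) → Matrix n k
colorMatrix f x i = if does (f x ≟ i) then 1ℚ else 0ℚ

-- Multisets of colours are represented by multiplicity vectors in ℕ^k.
-- color range of a hyperedge e: multiset {f(x) : x ∈ e}
colorRange : ∀ {n k} → (Fin n → Fin k) → Subset n → Vec ℕ k
colorRange f e = tabulate (λ c → countFin (λ y → does ((y ∈? e) ×-dec (f y ≟ c))))

edgeCount : ∀ {n d k} → Hypergraph n d → (Fin n → Fin k) → Fin n → Vec ℕ k → ℕ
edgeCount {n} H f x μ =
  countList (λ e → isEdge H e Data.Bool.∧ does ((x ∈? e) ×-dec ≡-dec _≟ℕ_ (colorRange f e) μ))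
            (allSubsets n)
  where open import Data.Nat using () renaming (_≟_ to _≟ℕ_)

Perfect : ∀ {n d k} → Hypergraph n d → (Fin n → Fin k) → Set
Perfect {n} {d} {k} H f =
  ∀ (i : Fin k) (μ : Vec ℕ k) (x y : Fin n) → f x ≡ i → f y ≡ i →
  edgeCount H f x μ ≡ edgeCount H f y μ

multiplicities : ∀ {m k} → (Fin m → Fin k) → Vec ℕ k
multiplicities γ = tabulate (λ l → countFin (λ j → does (γ j ≟ l)))

multinomialInv : ∀ {m k} → (Fin m → Fin k) → ℚ
multinomialInv {m} γ =
  (+ prodFinℕ (λ l → Vec.lookup (multiplicities γ) l !) / (m !)) {{m !≢0}}

module Submission where

-- The (x, β) entry of 𝔸 ∘ P is 1/m! (where d = m + 1) times the number of tuples ι ∈ [n]^m such that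
-- {x, ι₁, …, ι_m} is a hyperedge and f ∘ ι = β.  Grouping these tuples by the hyperedge they list, a hyperedge
-- through x is listed exactly when its colour range is the multiset {f x, β₁, …, β_m}, and then d₁!⋯d_k! times,
-- once for every ordering of each of its colour classes.  Hence (𝔸 ∘ P)_{x,β} = v · (m choose d₁, …, d_k)⁻¹,
-- where v counts the hyperedges through x with that colour range, while (P ∘ 𝕊)_{x,β} = s_{f x,β}.  So
-- 𝔸 ∘ P = P ∘ 𝕊 forces the stated entries of 𝕊, and such an 𝕊 exists iff v depends only on the colour of x.
-- As a multiset not containing the colour of x is the colour range of no hyperedge through x, this is perfectness.

open import Defs
import Algebra.Properties.CommutativeSemigroup as CommSemigroupProperties
open import Data.Bool as Bool using (Bool; true; false; _∧_; _∨_; not; if_then_else_; T)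
import Data.Bool.Properties as Boolₚ
open import Data.Empty using (⊥-elim)
open import Data.Fin using (Fin; zero; suc; _≟_)
open import Data.Fin.Subset using (Subset; ∣_∣; inside; outside; _─_; ⁅_⁆; _-_)
open import Data.Fin.Subset.Properties using (_∈?_)
import Data.Integer as ℤ
import Data.Integer.Properties as ℤₚ
open import Data.List as List using (List)
open import Data.Nat as ℕ using (ℕ; zero; suc; _!)
import Data.Nat.Properties as ℕₚ
open import Data.Product using (∃; _×_; _,_; proj₁; proj₂)
import Data.Rational as ℚ
import Data.Rational.Properties as ℚₚ
open import Data.Rational.Unnormalised as ℚᵘ using (mkℚᵘ; *≡*) renaming (_≃_ to _≃ᵘ_)
import Data.Rational.Unnormalised.Properties as ℚᵘₚ
open import Data.Unit using (tt)
open import Data.Vec using (Vec; []; _∷_; lookup; tabulate)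
open import Data.Vec.Properties using (≡-dec; lookup∘tabulate; tabulate∘lookup; tabulate-cong; lookup-replicate; []=⇒lookup)
open import Data.Vec.Functional using () renaming (_∷_ to _◂_)
open import Function using (_∘_)
open import Function.Bundles using (_⇔_; mk⇔; Equivalence)
open import Relation.Binary.Definitions using (DecidableEquality)
open import Relation.Binary.PropositionalEquality
open import Relation.Nullary using (yes; no; does; _×-dec_)
open import Relation.Nullary.Decidable using (dec-true; dec-false; does-⇔)

module Counting where

  open import Data.Nat using (_+_; _*_; _≤_; z≤n; s≤s)
  open CommSemigroupProperties ℕₚ.+-commutativeSemigroup
    using () renaming (interchange to +-interchange; x∙yz≈y∙xz to +-left-comm)
  open CommSemigroupProperties ℕₚ.*-commutativeSemigroup
    using () renaming (x∙yz≈y∙xz to *-left-comm)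

  𝟙 : Bool → ℕ
  𝟙 b = if b then 1 else 0

  countFin-cong : ∀ {n} {p q : Fin n → Bool} → (∀ i → p i ≡ q i) → countFin p ≡ countFin q
  countFin-cong {zero}  p≗q = refl
  countFin-cong {suc n} p≗q = cong₂ (λ b c → 𝟙 b + c) (p≗q zero) (countFin-cong (p≗q ∘ suc))

  countFin-false : ∀ n → countFin {n} (λ _ → false) ≡ 0
  countFin-false zero    = refl
  countFin-false (suc n) = countFin-false n

  countFin≡0⇒false : ∀ {n} (p : Fin n → Bool) → countFin p ≡ 0 → ∀ i → p i ≡ false
  countFin≡0⇒false {suc n} p #p≡0 i with p zero in p₀
  ... | true with () ← #p≡0
  countFin≡0⇒false {suc n} p #p≡0 zero    | false = p₀
  countFin≡0⇒false {suc n} p #p≡0 (suc i) | false = countFin≡0⇒false (p ∘ suc) #p≡0 i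

  countFin-∨ : ∀ {n} (p q : Fin n → Bool) → countFin (λ i → p i ∨ q i) ≤ countFin p + countFin q
  countFin-∨ {zero}  p q = z≤n
  countFin-∨ {suc n} p q =
    ℕₚ.≤-trans (ℕₚ.+-mono-≤ (𝟙-∨ (p zero) (q zero)) (countFin-∨ (p ∘ suc) (q ∘ suc)))
               (ℕₚ.≤-reflexive (+-interchange (𝟙 (p zero)) (𝟙 (q zero)) (countFin (p ∘ suc)) (countFin (q ∘ suc))))
    where
    𝟙-∨ : ∀ a b → 𝟙 (a ∨ b) ≤ 𝟙 a + 𝟙 b
    𝟙-∨ true  b = s≤s z≤n
    𝟙-∨ false b = ℕₚ.≤-refl

  countFin-≟ : ∀ {n} (a : Fin n) → countFin (λ y → does (a ≟ y)) ≡ 1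
  countFin-≟ {suc n} zero    = cong suc (countFin-false n)
  countFin-≟ {suc n} (suc a) = countFin-≟ a

  countFin-remove : ∀ {n} (p : Fin n → Bool) (a : Fin n) →
                    countFin p ≡ 𝟙 (p a) + countFin (λ y → p y ∧ not (does (a ≟ y)))
  countFin-remove {suc n} p zero =
    cong (𝟙 (p zero) +_) (cong₂ (λ b c → 𝟙 b + c) (sym (Boolₚ.∧-zeroʳ (p zero)))
                                (countFin-cong (λ i → sym (Boolₚ.∧-identityʳ (p (suc i))))))
  countFin-remove {suc n} p (suc a) =
    trans (cong (𝟙 (p zero) +_) (countFin-remove (p ∘ suc) a))
          (trans (+-left-comm (𝟙 (p zero)) (𝟙 (p (suc a))) rest)
                 (cong (λ b → 𝟙 (p (suc a)) + (𝟙 b + rest)) (sym (Boolₚ.∧-identityʳ (p zero)))))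
    where rest = countFin (λ y → p (suc y) ∧ not (does (a ≟ y)))

  -- Unlike the semiring sum of Algebra.Properties.Semiring.Sum, this one unfolds to ℕ._+_ itself,
  -- so that unification sees through it.
  sum : ∀ {n} → (Fin n → ℕ) → ℕ
  sum {zero}  g = 0
  sum {suc n} g = g zero + sum (g ∘ suc)

  sum-cong : ∀ {n} {g h : Fin n → ℕ} → (∀ i → g i ≡ h i) → sum g ≡ sum h
  sum-cong {zero}  g≗h = refl
  sum-cong {suc n} g≗h = cong₂ _+_ (g≗h zero) (sum-cong (g≗h ∘ suc))

  sum-zero : ∀ n → sum {n} (λ _ → 0) ≡ 0
  sum-zero zero    = refl
  sum-zero (suc n) = sum-zero n

  sum-+ : ∀ {n} (g h : Fin n → ℕ) → sum (λ i → g i + h i) ≡ sum g + sum h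
  sum-+ {zero}  g h = refl
  sum-+ {suc n} g h = trans (cong (g zero + h zero +_) (sum-+ (g ∘ suc) (h ∘ suc)))
                            (+-interchange (g zero) (h zero) (sum (g ∘ suc)) (sum (h ∘ suc)))

  sum-*ˡ : ∀ {n} c (g : Fin n → ℕ) → sum (λ i → c * g i) ≡ c * sum g
  sum-*ˡ {zero}  c g = sym (ℕₚ.*-zeroʳ c)
  sum-*ˡ {suc n} c g = trans (cong (c * g zero +_) (sum-*ˡ c (g ∘ suc))) (sym (ℕₚ.*-distribˡ-+ c (g zero) _))

  sum-𝟙-* : ∀ {n} (p : Fin n → Bool) c → sum (λ a → 𝟙 (p a) * c) ≡ countFin p * c
  sum-𝟙-* {zero}  p c = refl
  sum-𝟙-* {suc n} p c = trans (cong (𝟙 (p zero) * c +_) (sum-𝟙-* (p ∘ suc) c))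
                              (sym (ℕₚ.*-distribʳ-+ c (𝟙 (p zero)) _))

  tupleSum : ∀ m {n} → ((Fin m → Fin n) → ℕ) → ℕ
  tupleSum zero    g = g (λ ())
  tupleSum (suc m) g = sum (λ i → tupleSum m (λ ι → g (i ◂ ι)))

  tupleSum-cong : ∀ m {n} {g h : (Fin m → Fin n) → ℕ} → (∀ ι → g ι ≡ h ι) → tupleSum m g ≡ tupleSum m h
  tupleSum-cong zero    g≗h = g≗h _
  tupleSum-cong (suc m) g≗h = sum-cong (λ i → tupleSum-cong m (λ ι → g≗h (i ◂ ι)))

  tupleSum-zero : ∀ m {n} → tupleSum m {n} (λ _ → 0) ≡ 0
  tupleSum-zero zero        = refl
  tupleSum-zero (suc m) {n} = trans (sum-cong {n} (λ _ → tupleSum-zero m)) (sum-zero n)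

  tupleSum-+ : ∀ m {n} (g h : (Fin m → Fin n) → ℕ) → tupleSum m (λ ι → g ι + h ι) ≡ tupleSum m g + tupleSum m h
  tupleSum-+ zero    g h = refl
  tupleSum-+ (suc m) g h = trans (sum-cong (λ i → tupleSum-+ m (λ ι → g (i ◂ ι)) (λ ι → h (i ◂ ι))))
                                 (sum-+ (λ i → tupleSum m (λ ι → g (i ◂ ι))) (λ i → tupleSum m (λ ι → h (i ◂ ι))))

  tupleSum-*ˡ : ∀ m {n} c (g : (Fin m → Fin n) → ℕ) → tupleSum m (λ ι → c * g ι) ≡ c * tupleSum m g
  tupleSum-*ˡ zero    c g = refl
  tupleSum-*ˡ (suc m) c g = trans (sum-cong (λ i → tupleSum-*ˡ m c (λ ι → g (i ◂ ι))))
                                  (sum-*ˡ c (λ i → tupleSum m (λ ι → g (i ◂ ι))))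

  listSum : ∀ {A : Set} → List A → (A → ℕ) → ℕ
  listSum List.[]       g = 0
  listSum (a List.∷ as) g = g a + listSum as g

  listSum-cong : ∀ {A : Set} (l : List A) {g h : A → ℕ} → (∀ a → g a ≡ h a) → listSum l g ≡ listSum l h
  listSum-cong List.[]      g≗h = refl
  listSum-cong (a List.∷ l) g≗h = cong₂ _+_ (g≗h a) (listSum-cong l g≗h)

  listSum-zero : ∀ {A : Set} (l : List A) → listSum l (λ _ → 0) ≡ 0
  listSum-zero List.[]      = refl
  listSum-zero (a List.∷ l) = listSum-zero l

  listSum-++ : ∀ {A : Set} (l r : List A) g → listSum (l List.++ r) g ≡ listSum l g + listSum r g
  listSum-++ List.[]      r g = refl
  listSum-++ (a List.∷ l) r g = trans (cong (g a +_) (listSum-++ l r g)) (sym (ℕₚ.+-assoc (g a) _ _))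

  listSum-map : ∀ {A B : Set} (h : A → B) (l : List A) g → listSum (List.map h l) g ≡ listSum l (g ∘ h)
  listSum-map h List.[]      g = refl
  listSum-map h (a List.∷ l) g = cong (g (h a) +_) (listSum-map h l g)

  listSum-*ʳ : ∀ {A : Set} (l : List A) (g : A → ℕ) c → listSum l g * c ≡ listSum l (λ a → g a * c)
  listSum-*ʳ List.[]      g c = refl
  listSum-*ʳ (a List.∷ l) g c = trans (ℕₚ.*-distribʳ-+ c (g a) _) (cong (g a * c +_) (listSum-*ʳ l g c))

  tupleSum-listSum-comm : ∀ m {n} {A : Set} (l : List A) (g : (Fin m → Fin n) → A → ℕ) →
                          tupleSum m (λ ι → listSum l (g ι)) ≡ listSum l (λ a → tupleSum m (λ ι → g ι a))
  tupleSum-listSum-comm m List.[]      g = tupleSum-zero m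
  tupleSum-listSum-comm m (a List.∷ l) g =
    trans (tupleSum-+ m (λ ι → g ι a) (λ ι → listSum l (g ι)))
          (cong (tupleSum m (λ ι → g ι a) +_) (tupleSum-listSum-comm m l g))

  countList≡listSum : ∀ {A : Set} (p : A → Bool) l → countList p l ≡ listSum l (𝟙 ∘ p)
  countList≡listSum p List.[]      = refl
  countList≡listSum p (a List.∷ l) = cong (𝟙 (p a) +_) (countList≡listSum p l)

  countList-witness : ∀ {A : Set} (p : A → Bool) l → countList p l ≢ 0 → ∃ λ a → p a ≡ true
  countList-witness p List.[]      #p≢0 = ⊥-elim (#p≢0 refl)
  countList-witness p (a List.∷ l) #p≢0 with p a in pa
  ... | true  = a , pa
  ... | false = countList-witness p l #p≢0

  lookup-ext : ∀ {A : Set} {n} {u v : Vec A n} → (∀ i → lookup u i ≡ lookup v i) → u ≡ v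
  lookup-ext {u = u} {v} u≗v = trans (sym (tabulate∘lookup u)) (trans (tabulate-cong u≗v) (tabulate∘lookup v))

  infix 4 _≟ˢ_ _≟ᵛ_

  _≟ˢ_ : ∀ {n} → DecidableEquality (Subset n)
  _≟ˢ_ = ≡-dec Bool._≟_

  _≟ᵛ_ : ∀ {k} → DecidableEquality (Vec ℕ k)
  _≟ᵛ_ = ≡-dec ℕ._≟_

  lists : ∀ {m n} → (Fin m → Fin n) → Subset n → ℕ
  lists ι p = 𝟙 (does (image ι ≟ˢ p))

  listSum-allSubsets-select : ∀ n (s : Subset n) (g : Subset n → ℕ) →
                              listSum (allSubsets n) (λ e → 𝟙 (does (s ≟ˢ e)) * g e) ≡ g s
  listSum-allSubsets-select zero    []      g = trans (ℕₚ.+-identityʳ _) (ℕₚ.*-identityˡ _)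
  listSum-allSubsets-select (suc n) (b ∷ s) g =
    trans (listSum-++ (List.map (inside ∷_) (allSubsets n)) _ _)
          (trans (cong₂ _+_ (listSum-map (inside ∷_) (allSubsets n) _) (listSum-map (outside ∷_) (allSubsets n) _))
                 (select-head b))
    where
    select-head : ∀ b → listSum (allSubsets n) (λ e → 𝟙 (does (b ∷ s ≟ˢ true ∷ e)) * g (true ∷ e))
                      + listSum (allSubsets n) (λ e → 𝟙 (does (b ∷ s ≟ˢ false ∷ e)) * g (false ∷ e))
                      ≡ g (b ∷ s)
    select-head true  = trans (cong₂ _+_ (listSum-allSubsets-select n s (g ∘ (true ∷_))) (listSum-zero (allSubsets n)))
                              (ℕₚ.+-identityʳ (g (true ∷ s)))
    select-head false = trans (cong (_+ listSum (allSubsets n) (λ e → 𝟙 (does (s ≟ˢ e)) * g (false ∷ e)))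
                                    (listSum-zero (allSubsets n)))
                              (listSum-allSubsets-select n s (g ∘ (false ∷_)))

  ∣p∣≡countFin : ∀ {n} (p : Subset n) → ∣ p ∣ ≡ countFin (lookup p)
  ∣p∣≡countFin []          = refl
  ∣p∣≡countFin (true ∷ p)  = cong suc (∣p∣≡countFin p)
  ∣p∣≡countFin (false ∷ p) = ∣p∣≡countFin p

  ∈?-does : ∀ {n} (y : Fin n) (p : Subset n) → does (y ∈? p) ≡ lookup p y
  ∈?-does zero    (true ∷ p)  = refl
  ∈?-does zero    (false ∷ p) = refl
  ∈?-does (suc y) (b ∷ p)     = ∈?-does y p

  lookup-─ : ∀ {n} (p q : Subset n) y → lookup (p ─ q) y ≡ lookup p y ∧ not (lookup q y)
  lookup-─ (true  ∷ p) (true  ∷ q) zero    = refl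
  lookup-─ (true  ∷ p) (false ∷ q) zero    = refl
  lookup-─ (false ∷ p) (true  ∷ q) zero    = refl
  lookup-─ (false ∷ p) (false ∷ q) zero    = refl
  lookup-─ (_ ∷ p)     (_ ∷ q)     (suc y) = lookup-─ p q y

  lookup-⁅⁆ : ∀ {n} (a y : Fin n) → lookup ⁅ a ⁆ y ≡ does (a ≟ y)
  lookup-⁅⁆ zero    zero    = refl
  lookup-⁅⁆ zero    (suc y) = lookup-replicate y false
  lookup-⁅⁆ (suc a) zero    = refl
  lookup-⁅⁆ (suc a) (suc y) = lookup-⁅⁆ a y

  lookup-- : ∀ {n} (p : Subset n) a y → lookup (p - a) y ≡ lookup p y ∧ not (does (a ≟ y))
  lookup-- p a y = trans (lookup-─ p ⁅ a ⁆ y) (cong (λ b → lookup p y ∧ not b) (lookup-⁅⁆ a y))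

  countFin-- : ∀ {n} (p : Subset n) a → lookup p a ≡ true →
               countFin (lookup p) ≡ suc (countFin (lookup (p - a)))
  countFin-- p a a∈p = trans (countFin-remove (lookup p) a)
                             (cong₂ (λ b c → 𝟙 b + c) a∈p (countFin-cong (λ y → sym (lookup-- p a y))))

  lookup-image-suc : ∀ {m n} (g : Fin (suc m) → Fin n) y →
                     lookup (image g) y ≡ does (g zero ≟ y) ∨ lookup (image (g ∘ suc)) y
  lookup-image-suc g y = trans (lookup∘tabulate _ y) (cong (does (g zero ≟ y) ∨_) (sym (lookup∘tabulate _ y)))

  lookup-image-zero : ∀ {n} (g : Fin 0 → Fin n) y → lookup (image g) y ≡ false
  lookup-image-zero g y = lookup∘tabulate _ y

  head∈image : ∀ {m n} (a : Fin n) (ι : Fin m → Fin n) → lookup (image (a ◂ ι)) a ≡ true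
  head∈image a ι = trans (lookup-image-suc (a ◂ ι) a) (cong (_∨ lookup (image ι) a) (dec-true (a ≟ a) refl))

  countFin-image≤ : ∀ m {n} (g : Fin m → Fin n) → countFin (lookup (image g)) ≤ m
  countFin-image≤ zero {n} g = ℕₚ.≤-reflexive (trans (countFin-cong (lookup-image-zero g)) (countFin-false n))
  countFin-image≤ (suc m) g = begin
    countFin (lookup (image g))
      ≡⟨ countFin-cong (lookup-image-suc g) ⟩
    countFin (λ y → does (g zero ≟ y) ∨ lookup tail y)
      ≤⟨ countFin-∨ (λ y → does (g zero ≟ y)) (lookup tail) ⟩
    countFin (λ y → does (g zero ≟ y)) + countFin (lookup tail)
      ≡⟨ cong (_+ countFin (lookup tail)) (countFin-≟ (g zero)) ⟩
    suc (countFin (lookup tail))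
      ≤⟨ s≤s (countFin-image≤ m (g ∘ suc)) ⟩
    suc m ∎
    where
    open ℕₚ.≤-Reasoning
    tail = image (g ∘ suc)

  image-◂-absorb : ∀ {m n} (a : Fin n) (ι : Fin m → Fin n) → lookup (image ι) a ≡ true → image (a ◂ ι) ≡ image ι
  image-◂-absorb a ι a∈ι = lookup-ext λ y → trans (lookup-image-suc (a ◂ ι) y) (absorb y)
    where
    absorb : ∀ y → does (a ≟ y) ∨ lookup (image ι) y ≡ lookup (image ι) y
    absorb y with a ≟ y
    ... | yes refl = sym a∈ι
    ... | no  _    = refl

  head∉tail : ∀ {m n} (a : Fin n) (ι : Fin m → Fin n) →
              countFin (lookup (image (a ◂ ι))) ≡ suc m → lookup (image ι) a ≡ false
  head∉tail {m} a ι #image≡1+m with lookup (image ι) a in a∈ι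
  ... | false = refl
  ... | true  = ⊥-elim (ℕₚ.<-irrefl refl (subst (_≤ m) size≡ (countFin-image≤ m ι)))
    where
    size≡ : countFin (lookup (image ι)) ≡ suc m
    size≡ = trans (cong (countFin ∘ lookup) (sym (image-◂-absorb a ι a∈ι))) #image≡1+m

  image-◂≡⇔ : ∀ {m n} {p : Subset n} {a} (ι : Fin m → Fin n) →
              countFin (lookup p) ≡ suc m → lookup p a ≡ true →
              (image (a ◂ ι) ≡ p) ⇔ (image ι ≡ p - a)
  image-◂≡⇔ {p = p} {a} ι #p≡1+m a∈p = mk⇔ to from
    where
    to : image (a ◂ ι) ≡ p → image ι ≡ p - a
    to eq = lookup-ext λ y → sym (begin
      lookup (p - a) y
        ≡⟨ lookup-- p a y ⟩
      lookup p y ∧ not (does (a ≟ y))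
        ≡⟨ cong (λ s → lookup s y ∧ not (does (a ≟ y))) eq ⟨
      lookup (image (a ◂ ι)) y ∧ not (does (a ≟ y))
        ≡⟨ cong (_∧ not (does (a ≟ y))) (lookup-image-suc (a ◂ ι) y) ⟩
      (does (a ≟ y) ∨ lookup (image ι) y) ∧ not (does (a ≟ y))
        ≡⟨ strip y ⟩
      lookup (image ι) y ∎)
      where
      open ≡-Reasoning
      strip : ∀ y → (does (a ≟ y) ∨ lookup (image ι) y) ∧ not (does (a ≟ y)) ≡ lookup (image ι) y
      strip y with a ≟ y
      ... | yes refl = sym (head∉tail a ι (trans (cong (countFin ∘ lookup) eq) #p≡1+m))
      ... | no  _    = Boolₚ.∧-identityʳ _
    from : image ι ≡ p - a → image (a ◂ ι) ≡ p
    from ι≡p-a = lookup-ext λ y → trans (lookup-image-suc (a ◂ ι) y)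
                                         (trans (cong (λ s → does (a ≟ y) ∨ lookup s y) ι≡p-a) (restore y))
      where
      restore : ∀ y → does (a ≟ y) ∨ lookup (p - a) y ≡ lookup p y
      restore y rewrite lookup-- p a y with a ≟ y
      ... | yes refl = sym a∈p
      ... | no  _    = Boolₚ.∧-identityʳ (lookup p y)

  lookup-multiplicities : ∀ {m k} (γ : Fin m → Fin k) l →
                          lookup (multiplicities γ) l ≡ countFin (λ j → does (γ j ≟ l))
  lookup-multiplicities γ l = lookup∘tabulate _ l

  lookup-multiplicities-◂ : ∀ {m k} (b : Fin k) (γ : Fin m → Fin k) l →
                            lookup (multiplicities (b ◂ γ)) l ≡ 𝟙 (does (b ≟ l)) + lookup (multiplicities γ) l
  lookup-multiplicities-◂ b γ l =
    trans (lookup-multiplicities (b ◂ γ) l) (cong (𝟙 (does (b ≟ l)) +_) (sym (lookup-multiplicities γ l)))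

  multiplicityFactorials : ∀ {m k} → (Fin m → Fin k) → ℕ
  multiplicityFactorials γ = prodFinℕ (λ l → lookup (multiplicities γ) l !)

  prodFinℕ-cong : ∀ {n} {g h : Fin n → ℕ} → (∀ i → g i ≡ h i) → prodFinℕ g ≡ prodFinℕ h
  prodFinℕ-cong {zero}  g≗h = refl
  prodFinℕ-cong {suc n} g≗h = cong₂ _*_ (g≗h zero) (prodFinℕ-cong (g≗h ∘ suc))

  prodFinℕ-! : ∀ {k} (b : Fin k) (g : Fin k → ℕ) →
               prodFinℕ (λ l → (𝟙 (does (b ≟ l)) + g l) !) ≡ suc (g b) * prodFinℕ (λ l → g l !)
  prodFinℕ-! zero    g = ℕₚ.*-assoc (suc (g zero)) (g zero !) _
  prodFinℕ-! (suc b) g = trans (cong (g zero ! *_) (prodFinℕ-! b (g ∘ suc)))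
                               (*-left-comm (g zero !) (suc (g (suc b))) (prodFinℕ (λ l → g (suc l) !)))

  multiplicityFactorials-◂ : ∀ {m k} (b : Fin k) (γ : Fin m → Fin k) →
    multiplicityFactorials (b ◂ γ) ≡ suc (lookup (multiplicities γ) b) * multiplicityFactorials γ
  multiplicityFactorials-◂ b γ =
    trans (prodFinℕ-cong (λ l → cong _! (lookup-multiplicities-◂ b γ l)))
          (prodFinℕ-! b (lookup (multiplicities γ)))

  multiplicityFactorials-empty : ∀ {k} (γ : Fin 0 → Fin k) → multiplicityFactorials γ ≡ 1
  multiplicityFactorials-empty {k} γ =
    trans (prodFinℕ-cong (λ l → cong _! (lookup-multiplicities γ l))) (prodFinℕ-1 k)
    where
    prodFinℕ-1 : ∀ k → prodFinℕ {k} (λ _ → 1) ≡ 1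
    prodFinℕ-1 zero    = refl
    prodFinℕ-1 (suc k) = trans (ℕₚ.+-identityʳ (prodFinℕ {k} (λ _ → 1))) (prodFinℕ-1 k)

  module _ {n k} (f : Fin n → Fin k) where

    colorCount : Subset n → Fin k → ℕ
    colorCount p c = countFin (λ y → lookup p y ∧ does (f y ≟ c))

    lookup-colorRange : ∀ p c → lookup (colorRange f p) c ≡ colorCount p c
    lookup-colorRange p c =
      trans (lookup∘tabulate _ c) (countFin-cong (λ y → cong (_∧ does (f y ≟ c)) (∈?-does y p)))

    lookup-colorRange-- : ∀ {p a} c → lookup p a ≡ true →
      lookup (colorRange f p) c ≡ 𝟙 (does (f a ≟ c)) + lookup (colorRange f (p - a)) c
    lookup-colorRange-- {p} {a} c a∈p = begin
      lookup (colorRange f p) c                          ≡⟨ lookup-colorRange p c ⟩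
      colorCount p c                                    ≡⟨ countFin-remove _ a ⟩
      𝟙 (lookup p a ∧ does (f a ≟ c))
        + countFin (λ y → (lookup p y ∧ does (f y ≟ c)) ∧ not (does (a ≟ y)))
                                                         ≡⟨ cong₂ (λ b r → 𝟙 (b ∧ does (f a ≟ c)) + r) a∈p
                                                                  (countFin-cong remove-a) ⟩
      𝟙 (does (f a ≟ c)) + colorCount (p - a) c         ≡⟨ cong (𝟙 (does (f a ≟ c)) +_) (lookup-colorRange (p - a) c) ⟨
      𝟙 (does (f a ≟ c)) + lookup (colorRange f (p - a)) c ∎
      where
      open ≡-Reasoning
      remove-a : ∀ y → (lookup p y ∧ does (f y ≟ c)) ∧ not (does (a ≟ y)) ≡ lookup (p - a) y ∧ does (f y ≟ c)
      remove-a y = trans (Boolₚ.∧-assoc (lookup p y) _ _)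
                   (trans (cong (lookup p y ∧_) (Boolₚ.∧-comm (does (f y ≟ c)) _))
                   (trans (sym (Boolₚ.∧-assoc (lookup p y) _ _))
                          (cong (_∧ does (f y ≟ c)) (sym (lookup-- p a y)))))

    colorRange--⇔ : ∀ {m p a} {β : Fin m → Fin k} → lookup p a ≡ true →
      (colorRange f (p - a) ≡ multiplicities β) ⇔ (colorRange f p ≡ multiplicities (f a ◂ β))
    colorRange--⇔ {p = p} {a} {β} a∈p = mk⇔
      (λ eq → lookup-ext λ c → trans (lookup-colorRange-- c a∈p)
                                (trans (cong (λ v → 𝟙 (does (f a ≟ c)) + lookup v c) eq)
                                       (sym (lookup-multiplicities-◂ (f a) β c))))
      (λ eq → lookup-ext λ c → ℕₚ.+-cancelˡ-≡ (𝟙 (does (f a ≟ c))) _ _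
                                (trans (sym (lookup-colorRange-- c a∈p))
                                (trans (cong (λ v → lookup v c) eq) (lookup-multiplicities-◂ (f a) β c))))

    coloredAs : ∀ {m} → (Fin m → Fin n) → (Fin m → Fin k) → ℕ
    coloredAs ι β = prodFinℕ (λ j → 𝟙 (does (f (ι j) ≟ β j)))

    colorCount-head : ∀ {m} p (β : Fin (suc m) → Fin k) → colorRange f p ≡ multiplicities β →
                      colorCount p (β zero) ≡ suc (lookup (multiplicities (β ∘ suc)) (β zero))
    colorCount-head p β range≡β = begin
      colorCount p (β zero)                            ≡⟨ lookup-colorRange p (β zero) ⟨
      lookup (colorRange f p) (β zero)                 ≡⟨ cong (λ v → lookup v (β zero)) range≡β ⟩
      lookup (multiplicities β) (β zero)               ≡⟨ lookup-multiplicities-◂ (β zero) (β ∘ suc) (β zero) ⟩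
      𝟙 (does (β zero ≟ β zero)) + tailCount           ≡⟨ cong (λ b → 𝟙 b + tailCount) (dec-true (β zero ≟ β zero) refl) ⟩
      suc tailCount                                    ∎
      where
      open ≡-Reasoning
      tailCount = lookup (multiplicities (β ∘ suc)) (β zero)

    -- Listings of p with colour pattern β correspond to orderings of each colour class of p, whence d₁!⋯d_k!.
    mutual
      listings : ∀ m (p : Subset n) (β : Fin m → Fin k) → countFin (lookup p) ≡ m →
        tupleSum m (λ ι → lists ι p * coloredAs ι β)
          ≡ 𝟙 (does (colorRange f p ≟ᵛ multiplicities β)) * multiplicityFactorials β
      listings zero p β #p≡0 =
        cong₂ _*_ (trans (cong 𝟙 (dec-true (image {0} (λ ()) ≟ˢ p) image≡p))
                         (sym (cong 𝟙 (dec-true (colorRange f p ≟ᵛ multiplicities β) colorRange≡))))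
                  (sym (multiplicityFactorials-empty β))
        where
        p-empty : ∀ y → lookup p y ≡ false
        p-empty = countFin≡0⇒false (lookup p) #p≡0
        image≡p : image {0} (λ ()) ≡ p
        image≡p = lookup-ext λ y → trans (lookup-image-zero (λ ()) y) (sym (p-empty y))
        colorRange≡ : colorRange f p ≡ multiplicities β
        colorRange≡ = lookup-ext λ c →
          trans (lookup-colorRange p c)
                (trans (countFin-cong (λ y → cong (_∧ does (f y ≟ c)) (p-empty y)))
                       (trans (countFin-false n) (sym (lookup-multiplicities β c))))
      listings (suc m) p β #p≡1+m = begin
        sum (λ a → tupleSum m (λ ι → lists (a ◂ ι) p * (first a * coloredAs ι β′)))
          ≡⟨ sum-cong (λ a → trans (tupleSum-cong m (λ ι → *-left-comm (lists (a ◂ ι) p) (first a) (coloredAs ι β′)))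
                                   (tupleSum-*ˡ m (first a) (λ ι → lists (a ◂ ι) p * coloredAs ι β′))) ⟩
        sum (λ a → first a * tupleSum m (λ ι → lists (a ◂ ι) p * coloredAs ι β′))
          ≡⟨ sum-cong (λ a → cong (first a *_) (listingsFrom a p β′ #p≡1+m)) ⟩
        sum (λ a → first a * (𝟙 (lookup p a ∧ does (colorRange f p ≟ᵛ multiplicities (f a ◂ β′))) * D′))
          ≡⟨ sum-cong head-coloured ⟩
        sum (λ a → 𝟙 (lookup p a ∧ does (f a ≟ β zero)) * K)
          ≡⟨ sum-𝟙-* (λ a → lookup p a ∧ does (f a ≟ β zero)) K ⟩
        colorCount p (β zero) * K
          ≡⟨ count-heads ⟩
        𝟙 (does (colorRange f p ≟ᵛ multiplicities β)) * multiplicityFactorials β ∎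
        where
        open ≡-Reasoning
        β′ : Fin m → Fin k
        β′ = β ∘ suc
        D′ = multiplicityFactorials β′
        K = 𝟙 (does (colorRange f p ≟ᵛ multiplicities β)) * D′
        first : Fin n → ℕ
        first a = 𝟙 (does (f a ≟ β zero))
        -- multiplicities (β zero ◂ β′) computes to multiplicities β.
        head-coloured : ∀ a → first a * (𝟙 (lookup p a ∧ does (colorRange f p ≟ᵛ multiplicities (f a ◂ β′))) * D′)
                              ≡ 𝟙 (lookup p a ∧ does (f a ≟ β zero)) * K
        head-coloured a with f a ≟ β zero
        ... | no _ = cong (λ b → 𝟙 b * K) (sym (Boolₚ.∧-zeroʳ (lookup p a)))
        ... | yes fa≡β₀ rewrite fa≡β₀ with lookup p a
        ...   | true  = refl
        ...   | false = refl
        count-heads : colorCount p (β zero) * K ≡ 𝟙 (does (colorRange f p ≟ᵛ multiplicities β)) * multiplicityFactorials β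
        count-heads with colorRange f p ≟ᵛ multiplicities β
        ... | no  _ = ℕₚ.*-zeroʳ (colorCount p (β zero))
        ... | yes range≡β = begin
          colorCount p (β zero) * (1 * D′)
            ≡⟨ cong₂ _*_ (colorCount-head p β range≡β) (ℕₚ.*-identityˡ D′) ⟩
          suc (lookup (multiplicities β′) (β zero)) * D′
            ≡⟨ multiplicityFactorials-◂ (β zero) β′ ⟨
          multiplicityFactorials β
            ≡⟨ ℕₚ.*-identityˡ _ ⟨
          1 * multiplicityFactorials β ∎

      listingsFrom : ∀ {m} (a : Fin n) (p : Subset n) (β : Fin m → Fin k) → countFin (lookup p) ≡ suc m →
        tupleSum m (λ ι → lists (a ◂ ι) p * coloredAs ι β)
          ≡ 𝟙 (lookup p a ∧ does (colorRange f p ≟ᵛ multiplicities (f a ◂ β))) * multiplicityFactorials β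
      listingsFrom {m} a p β #p≡1+m with lookup p a in a∈p
      ... | false = trans (tupleSum-cong m λ ι → cong (λ b → 𝟙 b * coloredAs ι β)
                                                     (dec-false (image (a ◂ ι) ≟ˢ p) (head∉ ι)))
                          (tupleSum-zero m)
        where
        head∉ : ∀ ι → image (a ◂ ι) ≢ p
        head∉ ι eq with () ← trans (sym (head∈image a ι)) (trans (cong (λ s → lookup s a) eq) a∈p)
      ... | true = begin
        tupleSum m (λ ι → lists (a ◂ ι) p * coloredAs ι β)
          ≡⟨ tupleSum-cong m (λ ι → cong (λ b → 𝟙 b * coloredAs ι β)
                                         (does-⇔ (image-◂≡⇔ ι #p≡1+m a∈p)
                                                 (image (a ◂ ι) ≟ˢ p) (image ι ≟ˢ p - a))) ⟩
        tupleSum m (λ ι → lists ι (p - a) * coloredAs ι β)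
          ≡⟨ listings m (p - a) β (ℕₚ.suc-injective (trans (sym (countFin-- p a a∈p)) #p≡1+m)) ⟩
        𝟙 (does (colorRange f (p - a) ≟ᵛ multiplicities β)) * multiplicityFactorials β
          ≡⟨ cong (λ b → 𝟙 b * multiplicityFactorials β)
                  (does-⇔ (colorRange--⇔ {β = β} a∈p) (colorRange f (p - a) ≟ᵛ _) (colorRange f p ≟ᵛ _)) ⟩
        𝟙 (does (colorRange f p ≟ᵛ multiplicities (f a ◂ β))) * multiplicityFactorials β ∎
        where open ≡-Reasoning

  enumerate : ∀ {m n} (p : Subset n) → countFin (lookup p) ≡ m →
              ∃ λ (ι : Fin m → Fin n) → ∀ (g : Fin n → Bool) → countFin (λ y → lookup p y ∧ g y) ≡ countFin (g ∘ ι)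
  enumerate []                refl = (λ ()) , λ _ → refl
  enumerate {zero}  (true ∷ p) ()
  enumerate {suc m} (true ∷ p) #p≡1+m with enumerate p (ℕₚ.suc-injective #p≡1+m)
  ... | ι , count = zero ◂ (suc ∘ ι) , λ g → cong (𝟙 (g zero) +_) (count (g ∘ suc))
  enumerate (false ∷ p) #p≡m with enumerate p #p≡m
  ... | ι , count = suc ∘ ι , λ g → count (g ∘ suc)

  module _ {n m k} (H : Hypergraph n (suc m)) (f : Fin n → Fin k) where

    edgeSize : ∀ e → isEdge H e ≡ true → countFin (lookup e) ≡ suc m
    edgeSize e isE = trans (sym (∣p∣≡countFin e)) (uniform H e (subst T (sym isE) tt))

    edgeListingsAt : ∀ x (β : Fin m → Fin k) e →
      tupleSum m (λ ι → lists (x ◂ ι) e * 𝟙 (isEdge H e) * coloredAs f ι β)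
        ≡ 𝟙 (isEdge H e ∧ does ((x ∈? e) ×-dec (colorRange f e ≟ᵛ multiplicities (f x ◂ β))))
          * multiplicityFactorials β
    edgeListingsAt x β e with isEdge H e in isE
    ... | false = trans (tupleSum-cong m λ ι → cong (_* coloredAs f ι β) (ℕₚ.*-zeroʳ (lists (x ◂ ι) e)))
                        (tupleSum-zero m)
    ... | true  = begin
      tupleSum m (λ ι → lists (x ◂ ι) e * 1 * coloredAs f ι β)
        ≡⟨ tupleSum-cong m (λ ι → cong (_* coloredAs f ι β) (ℕₚ.*-identityʳ (lists (x ◂ ι) e))) ⟩
      tupleSum m (λ ι → lists (x ◂ ι) e * coloredAs f ι β)
        ≡⟨ listingsFrom f x e β (edgeSize e isE) ⟩
      𝟙 (lookup e x ∧ does (colorRange f e ≟ᵛ multiplicities (f x ◂ β))) * multiplicityFactorials β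
        ≡⟨ cong (λ b → 𝟙 (b ∧ does (colorRange f e ≟ᵛ multiplicities (f x ◂ β))) * multiplicityFactorials β)
                (∈?-does x e) ⟨
      𝟙 (does (x ∈? e) ∧ does (colorRange f e ≟ᵛ multiplicities (f x ◂ β))) * multiplicityFactorials β ∎
      where open ≡-Reasoning

    edgeListings : ∀ x (β : Fin m → Fin k) →
      tupleSum m (λ ι → 𝟙 (isEdge H (image (x ◂ ι))) * coloredAs f ι β)
        ≡ edgeCount H f x (multiplicities (f x ◂ β)) * multiplicityFactorials β
    edgeListings x β = begin
      tupleSum m (λ ι → 𝟙 (isEdge H (image (x ◂ ι))) * coloredAs f ι β)
        ≡⟨ tupleSum-cong m (λ ι → cong (_* coloredAs f ι β)
                                       (listSum-allSubsets-select n (image (x ◂ ι)) (𝟙 ∘ isEdge H))) ⟨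
      tupleSum m (λ ι → listSum subsets (λ e → lists (x ◂ ι) e * 𝟙 (isEdge H e)) * coloredAs f ι β)
        ≡⟨ tupleSum-cong m (λ ι → listSum-*ʳ subsets (λ e → lists (x ◂ ι) e * 𝟙 (isEdge H e)) (coloredAs f ι β)) ⟩
      tupleSum m (λ ι → listSum subsets (λ e → lists (x ◂ ι) e * 𝟙 (isEdge H e) * coloredAs f ι β))
        ≡⟨ tupleSum-listSum-comm m subsets (λ ι e → lists (x ◂ ι) e * 𝟙 (isEdge H e) * coloredAs f ι β) ⟩
      listSum subsets (λ e → tupleSum m (λ ι → lists (x ◂ ι) e * 𝟙 (isEdge H e) * coloredAs f ι β))
        ≡⟨ listSum-cong subsets (edgeListingsAt x β) ⟩
      listSum subsets (λ e → 𝟙 (counted e) * multiplicityFactorials β)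
        ≡⟨ listSum-*ʳ subsets (𝟙 ∘ counted) (multiplicityFactorials β) ⟨
      listSum subsets (𝟙 ∘ counted) * multiplicityFactorials β
        ≡⟨ cong (_* multiplicityFactorials β) (countList≡listSum counted subsets) ⟨
      edgeCount H f x (multiplicities (f x ◂ β)) * multiplicityFactorials β ∎
      where
      open ≡-Reasoning
      subsets = allSubsets n
      counted : Subset n → Bool
      counted e = isEdge H e ∧ does ((x ∈? e) ×-dec (colorRange f e ≟ᵛ multiplicities (f x ◂ β)))

    edgeCount≢0⇒multiplicities-◂ : ∀ x μ → edgeCount H f x μ ≢ 0 →
                                    ∃ λ (β : Fin m → Fin k) → μ ≡ multiplicities (f x ◂ β)
    edgeCount≢0⇒multiplicities-◂ x μ #≢0 with countList-witness _ (allSubsets n) #≢0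
    ... | e , counted with isEdge H e in isE | x ∈? e | colorRange f e ≟ᵛ μ
    ...   | false | _       | _           with () ← counted
    ...   | true  | no _    | _           with () ← counted
    ...   | true  | yes _   | no _        with () ← counted
    ...   | true  | yes x∈e | yes range≡μ =
      f ∘ ι , trans (sym range≡μ) (Equivalence.to (colorRange--⇔ f {β = f ∘ ι} x∈e′) range[e-x]≡)
      where
      x∈e′ : lookup e x ≡ true
      x∈e′ = []=⇒lookup x∈e
      listing = enumerate (e - x) (ℕₚ.suc-injective (trans (sym (countFin-- e x x∈e′)) (edgeSize e isE)))
      ι = proj₁ listing
      range[e-x]≡ : colorRange f (e - x) ≡ multiplicities (f ∘ ι)
      range[e-x]≡ = lookup-ext λ c → trans (lookup-colorRange f (e - x) c)
                                     (trans (proj₂ listing (λ y → does (f y ≟ c)))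
                                            (sym (lookup-multiplicities (f ∘ ι) c)))

open Counting
open ℤ using (+_)
open ℚ using (ℚ; 0ℚ; 1ℚ; _+_; _*_; _/_; 1/_; toℚᵘ)

fromℕ : ℕ → ℚ
fromℕ n = + n / 1

-- Casts from ℕ are transported from ℚᵘ along the injective homomorphism toℚᵘ.
toℚᵘ-/ : ∀ i d .{{_ : ℕ.NonZero d}} → toℚᵘ (+ i / d) ≃ᵘ mkℚᵘ (+ i) (ℕ.pred d)
toℚᵘ-/ i (suc d) = ℚₚ.toℚᵘ-fromℚᵘ (mkℚᵘ (+ i) d)

fromℕ-+ : ∀ a b → fromℕ (a ℕ.+ b) ≡ fromℕ a + fromℕ b
fromℕ-+ a b = ℚₚ.toℚᵘ-injective (begin
  toℚᵘ (fromℕ (a ℕ.+ b))              ≈⟨ toℚᵘ-/ (a ℕ.+ b) 1 ⟩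
  mkℚᵘ (+ (a ℕ.+ b)) 0                ≈⟨ *≡* (cong (ℤ._* + 1) (trans (ℤₚ.pos-+ a b)
                                              (sym (cong₂ ℤ._+_ (ℤₚ.*-identityʳ (+ a)) (ℤₚ.*-identityʳ (+ b)))))) ⟩
  mkℚᵘ (+ a) 0 ℚᵘ.+ mkℚᵘ (+ b) 0      ≈⟨ ℚᵘₚ.+-cong (toℚᵘ-/ a 1) (toℚᵘ-/ b 1) ⟨
  toℚᵘ (fromℕ a) ℚᵘ.+ toℚᵘ (fromℕ b)  ≈⟨ ℚₚ.toℚᵘ-homo-+ (fromℕ a) (fromℕ b) ⟨
  toℚᵘ (fromℕ a + fromℕ b)            ∎)
  where open ℚᵘₚ.≃-Reasoning

fromℕ-* : ∀ a b → fromℕ (a ℕ.* b) ≡ fromℕ a * fromℕ b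
fromℕ-* a b = ℚₚ.toℚᵘ-injective (begin
  toℚᵘ (fromℕ (a ℕ.* b))              ≈⟨ toℚᵘ-/ (a ℕ.* b) 1 ⟩
  mkℚᵘ (+ (a ℕ.* b)) 0                ≈⟨ *≡* (cong (ℤ._* + 1) (ℤₚ.pos-* a b)) ⟩
  mkℚᵘ (+ a) 0 ℚᵘ.* mkℚᵘ (+ b) 0      ≈⟨ ℚᵘₚ.*-cong (toℚᵘ-/ a 1) (toℚᵘ-/ b 1) ⟨
  toℚᵘ (fromℕ a) ℚᵘ.* toℚᵘ (fromℕ b)  ≈⟨ ℚₚ.toℚᵘ-homo-* (fromℕ a) (fromℕ b) ⟨
  toℚᵘ (fromℕ a * fromℕ b)            ∎)
  where open ℚᵘₚ.≃-Reasoning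

fromℕ-/ : ∀ i d .{{_ : ℕ.NonZero d}} → + i / d ≡ fromℕ i * (+ 1 / d)
fromℕ-/ i (suc d) = ℚₚ.toℚᵘ-injective (begin
  toℚᵘ (+ i / suc d)                          ≈⟨ toℚᵘ-/ i (suc d) ⟩
  mkℚᵘ (+ i) d                                ≈⟨ *≡* (trans (cong (λ z → + i ℤ.* + z) (ℕₚ.+-identityʳ (suc d)))
                                                            (cong (ℤ._* + suc d) (sym (ℤₚ.*-identityʳ (+ i))))) ⟩
  mkℚᵘ (+ i) 0 ℚᵘ.* mkℚᵘ (+ 1) d              ≈⟨ ℚᵘₚ.*-cong (toℚᵘ-/ i 1) (toℚᵘ-/ 1 (suc d)) ⟨
  toℚᵘ (fromℕ i) ℚᵘ.* toℚᵘ (+ 1 / suc d)      ≈⟨ ℚₚ.toℚᵘ-homo-* (fromℕ i) (+ 1 / suc d) ⟨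
  toℚᵘ (fromℕ i * (+ 1 / suc d))              ∎)
  where open ℚᵘₚ.≃-Reasoning

fromℕ-injective : ∀ {a b} → fromℕ a ≡ fromℕ b → a ≡ b
fromℕ-injective {a} {b} eq
  with ℚᵘₚ.≃-trans (ℚᵘₚ.≃-sym (toℚᵘ-/ a 1)) (ℚᵘₚ.≃-trans (ℚₚ.toℚᵘ-cong eq) (toℚᵘ-/ b 1))
... | *≡* a*1≡b*1 = ℤₚ.+-injective (trans (sym (ℤₚ.*-identityʳ (+ a))) (trans a*1≡b*1 (ℤₚ.*-identityʳ (+ b))))

fromℕ-𝟙 : ∀ b → fromℕ (𝟙 b) ≡ (if b then 1ℚ else 0ℚ)
fromℕ-𝟙 true  = refl
fromℕ-𝟙 false = refl

*-cancelʳ-≡ : ∀ p q r .{{_ : ℚ.NonZero r}} → p * r ≡ q * r → p ≡ q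
*-cancelʳ-≡ p q r pr≡qr = begin
  p                ≡⟨ ℚₚ.*-identityʳ p ⟨
  p * 1ℚ           ≡⟨ cong (p *_) (ℚₚ.*-inverseʳ r) ⟨
  p * (r * 1/ r)   ≡⟨ ℚₚ.*-assoc p r (1/ r) ⟨
  p * r * 1/ r     ≡⟨ cong (_* 1/ r) pr≡qr ⟩
  q * r * 1/ r     ≡⟨ ℚₚ.*-assoc q r (1/ r) ⟩
  q * (r * 1/ r)   ≡⟨ cong (q *_) (ℚₚ.*-inverseʳ r) ⟩
  q * 1ℚ           ≡⟨ ℚₚ.*-identityʳ q ⟩
  q                ∎
  where open ≡-Reasoning

sumFin-cong : ∀ {n} {g h : Fin n → ℚ} → (∀ i → g i ≡ h i) → sumFin g ≡ sumFin h
sumFin-cong {zero}  g≗h = refl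
sumFin-cong {suc n} g≗h = cong₂ _+_ (g≗h zero) (sumFin-cong (g≗h ∘ suc))

sumTuples-cong : ∀ m {n} {g h : (Fin m → Fin n) → ℚ} → (∀ ι → g ι ≡ h ι) → sumTuples m g ≡ sumTuples m h
sumTuples-cong zero    g≗h = g≗h _
sumTuples-cong (suc m) g≗h = sumFin-cong (λ i → sumTuples-cong m (λ ι → g≗h (i ◂ ι)))

sumFin-fromℕ-* : ∀ {n} (g : Fin n → ℕ) r → sumFin (λ i → fromℕ (g i) * r) ≡ fromℕ (sum g) * r
sumFin-fromℕ-* {zero}  g r = sym (ℚₚ.*-zeroˡ r)
sumFin-fromℕ-* {suc n} g r = begin
  fromℕ (g zero) * r + sumFin (λ i → fromℕ (g (suc i)) * r)
                                                             ≡⟨ cong (λ s → fromℕ (g zero) * r + s) (sumFin-fromℕ-* (g ∘ suc) r) ⟩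
  fromℕ (g zero) * r + fromℕ (sum (g ∘ suc)) * r             ≡⟨ ℚₚ.*-distribʳ-+ r (fromℕ (g zero)) _ ⟨
  (fromℕ (g zero) + fromℕ (sum (g ∘ suc))) * r               ≡⟨ cong (_* r) (fromℕ-+ (g zero) (sum (g ∘ suc))) ⟨
  fromℕ (g zero ℕ.+ sum (g ∘ suc)) * r                       ∎
  where open ≡-Reasoning

sumTuples-fromℕ-* : ∀ m {n} (g : (Fin m → Fin n) → ℕ) r →
                    sumTuples m (λ ι → fromℕ (g ι) * r) ≡ fromℕ (tupleSum m g) * r
sumTuples-fromℕ-* zero    g r = refl
sumTuples-fromℕ-* (suc m) g r =
  trans (sumFin-cong (λ i → sumTuples-fromℕ-* m (λ ι → g (i ◂ ι)) r))
        (sumFin-fromℕ-* (λ i → tupleSum m (λ ι → g (i ◂ ι))) r)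

prodFin-𝟙 : ∀ {m} (b : Fin m → Bool) → prodFin (λ j → if b j then 1ℚ else 0ℚ) ≡ fromℕ (prodFinℕ (𝟙 ∘ b))
prodFin-𝟙 {zero}  b = refl
prodFin-𝟙 {suc m} b = trans (cong₂ _*_ (sym (fromℕ-𝟙 (b zero))) (prodFin-𝟙 (b ∘ suc)))
                            (sym (fromℕ-* (𝟙 (b zero)) (prodFinℕ (𝟙 ∘ b ∘ suc))))

sumFin-select : ∀ {k} (c : Fin k) (h : Fin k → ℚ) → sumFin (λ i → (if does (c ≟ i) then 1ℚ else 0ℚ) * h i) ≡ h c
sumFin-select zero    h =
  trans (cong₂ _+_ (ℚₚ.*-identityˡ (h zero)) (sumFin-zero (h ∘ suc))) (ℚₚ.+-identityʳ (h zero))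
  where
  sumFin-zero : ∀ {n} (g : Fin n → ℚ) → sumFin (λ i → 0ℚ * g i) ≡ 0ℚ
  sumFin-zero {zero}  g = refl
  sumFin-zero {suc n} g = cong₂ _+_ (ℚₚ.*-zeroˡ (g zero)) (sumFin-zero (g ∘ suc))
sumFin-select (suc c) h =
  trans (cong₂ _+_ (ℚₚ.*-zeroˡ (h zero)) (sumFin-select c (h ∘ suc))) (ℚₚ.+-identityˡ (h (suc c)))

multinomialInv≢0 : ∀ {m k} (γ : Fin m → Fin k) → ℚ.NonZero (multinomialInv γ)
multinomialInv≢0 {m} γ =
  ℚₚ.pos⇒nonZero (multinomialInv γ)
    {{ℚₚ.normalize-pos _ (m !) {{m ℕₚ.!≢0}} {{factorials≢0 (lookup (multiplicities γ))}}}}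
  where
  factorials≢0 : ∀ {k} (g : Fin k → ℕ) → ℕ.NonZero (prodFinℕ (λ l → g l !))
  factorials≢0 {zero}  g = _
  factorials≢0 {suc k} g = ℕₚ.m*n≢0 (g zero !) _ {{g zero ℕₚ.!≢0}} {{factorials≢0 (g ∘ suc)}}

colorMatrix-M∘ : ∀ {m n k} (f : Fin n → Fin k) (S : Array m k k) x β → (colorMatrix f M∘ S) x β ≡ S (f x) β
colorMatrix-M∘ f S x β = sumFin-select (f x) (λ i → S i β)

module _ {n m k} (H : Hypergraph n (suc m)) (f : Fin n → Fin k) where

  adjacency-∘M-colorMatrix : ∀ x β →
    (adjacency H ∘M colorMatrix f) x β ≡ fromℕ (edgeCount H f x (multiplicities (f x ◂ β))) * multinomialInv β
  adjacency-∘M-colorMatrix x β = begin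
    sumTuples m (λ ι → adjacency H x ι * prodFin (λ j → colorMatrix f (ι j) (β j)))
      ≡⟨ sumTuples-cong m term ⟩
    sumTuples m (λ ι → fromℕ (𝟙 (isEdge H (image (x ◂ ι))) ℕ.* coloredAs f ι β) * q)
      ≡⟨ sumTuples-fromℕ-* m (λ ι → 𝟙 (isEdge H (image (x ◂ ι))) ℕ.* coloredAs f ι β) q ⟩
    fromℕ (tupleSum m (λ ι → 𝟙 (isEdge H (image (x ◂ ι))) ℕ.* coloredAs f ι β)) * q
      ≡⟨ cong (λ N → fromℕ N * q) (edgeListings H f x β) ⟩
    fromℕ (v ℕ.* multiplicityFactorials β) * q
      ≡⟨ cong (_* q) (fromℕ-* v (multiplicityFactorials β)) ⟩
    fromℕ v * fromℕ (multiplicityFactorials β) * q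
      ≡⟨ ℚₚ.*-assoc (fromℕ v) _ q ⟩
    fromℕ v * (fromℕ (multiplicityFactorials β) * q)
      ≡⟨ cong (fromℕ v *_) (fromℕ-/ (multiplicityFactorials β) (m !) {{m ℕₚ.!≢0}}) ⟨
    fromℕ v * multinomialInv β ∎
    where
    open ≡-Reasoning
    v = edgeCount H f x (multiplicities (f x ◂ β))
    q = (+ 1 / (m !)) {{m ℕₚ.!≢0}}
    term : ∀ ι → adjacency H x ι * prodFin (λ j → colorMatrix f (ι j) (β j))
                 ≡ fromℕ (𝟙 (isEdge H (image (x ◂ ι))) ℕ.* coloredAs f ι β) * q
    term ι = begin
      (if e then q else 0ℚ) * prodFin (λ j → colorMatrix f (ι j) (β j))
        ≡⟨ cong₂ _*_ (edge-entry e) (prodFin-𝟙 (λ j → does (f (ι j) ≟ β j))) ⟩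
      fromℕ (𝟙 e) * q * fromℕ (coloredAs f ι β)
        ≡⟨ ℚₚ.*-assoc (fromℕ (𝟙 e)) q _ ⟩
      fromℕ (𝟙 e) * (q * fromℕ (coloredAs f ι β))
        ≡⟨ cong (fromℕ (𝟙 e) *_) (ℚₚ.*-comm q _) ⟩
      fromℕ (𝟙 e) * (fromℕ (coloredAs f ι β) * q)
        ≡⟨ ℚₚ.*-assoc (fromℕ (𝟙 e)) _ q ⟨
      fromℕ (𝟙 e) * fromℕ (coloredAs f ι β) * q
        ≡⟨ cong (_* q) (fromℕ-* (𝟙 e) (coloredAs f ι β)) ⟨
      fromℕ (𝟙 e ℕ.* coloredAs f ι β) * q ∎
      where
      e = isEdge H (image (x ◂ ι))
      edge-entry : ∀ b → (if b then q else 0ℚ) ≡ fromℕ (𝟙 b) * q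
      edge-entry true  = sym (ℚₚ.*-identityˡ q)
      edge-entry false = sym (ℚₚ.*-zeroˡ q)

  Intertwines : Array m k k → Set
  Intertwines S = ∀ x β → (adjacency H ∘M colorMatrix f) x β ≡ (colorMatrix f M∘ S) x β

  intertwiner-entries : ∀ S → Intertwines S → ∀ γ₁ γr x → f x ≡ γ₁ →
    S γ₁ γr ≡ fromℕ (edgeCount H f x (multiplicities (γ₁ ◂ γr))) * multinomialInv γr
  intertwiner-entries S intertwines .(f x) γr x refl =
    trans (sym (colorMatrix-M∘ f S x γr)) (trans (sym (intertwines x γr)) (adjacency-∘M-colorMatrix x γr))

  intertwined-edgeCounts : ∀ S → Intertwines S → ∀ {c x y} → f x ≡ c → f y ≡ c →
    ∀ μ → edgeCount H f x μ ≢ 0 → edgeCount H f x μ ≡ edgeCount H f y μ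
  intertwined-edgeCounts S intertwines {x = x} {y} refl fy≡fx μ x≢0
    with edgeCount≢0⇒multiplicities-◂ H f x μ x≢0
  ... | β , refl = fromℕ-injective (*-cancelʳ-≡ _ _ (multinomialInv β) {{multinomialInv≢0 β}}
    (trans (sym (intertwiner-entries S intertwines (f x) β x refl))
           (intertwiner-entries S intertwines (f x) β y fy≡fx)))

  intertwiner⇒perfect : (∃ λ S → Intertwines S) → Perfect H f
  intertwiner⇒perfect (S , intertwines) c μ x y fx≡c fy≡c
    with edgeCount H f x μ ℕ.≟ 0 | edgeCount H f y μ ℕ.≟ 0
  ... | no  x≢0 | _       = intertwined-edgeCounts S intertwines fx≡c fy≡c μ x≢0
  ... | yes x≡0 | no  y≢0 = sym (intertwined-edgeCounts S intertwines fy≡c fx≡c μ y≢0)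
  ... | yes x≡0 | yes y≡0 = trans x≡0 (sym y≡0)

  perfect⇒intertwiner : Surjective f → Perfect H f → ∃ λ S → Intertwines S
  perfect⇒intertwiner surj perfect = S , intertwines
    where
    representative : Fin k → Fin n
    representative c = proj₁ (surj c)
    S : Array m k k
    S c β = fromℕ (edgeCount H f (representative c) (multiplicities (c ◂ β))) * multinomialInv β
    intertwines : Intertwines S
    intertwines x β = begin
      (adjacency H ∘M colorMatrix f) x β
        ≡⟨ adjacency-∘M-colorMatrix x β ⟩
      fromℕ (edgeCount H f x μ) * multinomialInv β
        ≡⟨ cong (λ v → fromℕ v * multinomialInv β) (perfect (f x) μ x _ refl (proj₂ (surj (f x)))) ⟩
      fromℕ (edgeCount H f (representative (f x)) μ) * multinomialInv β
        ≡⟨ colorMatrix-M∘ f S x β ⟨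
      (colorMatrix f M∘ S) x β ∎
      where
      open ≡-Reasoning
      μ = multiplicities (f x ◂ β)

theorem5 : ∀ {n m k : ℕ} (H : Hypergraph n (suc m)) (f : Fin n → Fin k) →
  Surjective f →
  (Perfect H f ⇔
    ∃ (λ (S : Array m k k) → ∀ x β →
        (adjacency H ∘M colorMatrix f) x β ≡ (colorMatrix f M∘ S) x β))
  × (∀ (S : Array m k k) →
      (∀ x β → (adjacency H ∘M colorMatrix f) x β ≡ (colorMatrix f M∘ S) x β) →
      Perfect H f →
      ∀ (γ₁ : Fin k) (γr : Fin m → Fin k) (x : Fin n) → f x ≡ γ₁ →
      S γ₁ γr ≡ ((+ edgeCount H f x (multiplicities (γ₁ ◂ γr))) / 1) * multinomialInv γr)
theorem5 H f surj =
  mk⇔ (perfect⇒intertwiner H f surj) (intertwiner⇒perfect H f) ,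
  -- The entries are determined by any intertwining S.
  λ S intertwines _ → intertwiner-entries H f S intertwines
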